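{- For $n\ge 2$ let $f_n(t)=g_{n,\lfloor n/2\rfloor}(t)$, where $$g_{n,d}(t)=\sum_{i=1}^{\min(d,n-d)} \frac{(n-i-1)!}{(d-i)!\,(n-d-i)!\,(i-1)!}\, t^i,$$ and let $r_{2m+1}(1)=f_{2m}(1)/f_{2m+1}(1)$. Then for all $m\ge 3$, $$m+1-2m\,r_{2m+1}(1)-m\,r_{2m+1}(1)^2>0.$$
   Context: $g_{n,d}$ is Speyer's $g$-polynomial of the uniform matroid $U_{n,d}$. -}

module Defs where

open import Data.Nat as ℕ using (ℕ; zero; suc; _∸_; _⊓_; _!; NonZero)
open import Data.Nat.Properties using (_!≢0; m*n≢0)
open import Data.Integer using (+_)
open import Data.Rational using (ℚ; 0ℚ; 1ℚ; _+_; _*_; _/_; _÷_; ≢-nonZero)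
open import Data.Rational.Properties using (_≟_)
open import Relation.Nullary using (yes; no)

ℕtoℚ : ℕ → ℚ
ℕtoℚ k = (+ k) / 1

_^ℚ_ : ℚ → ℕ → ℚ
t ^ℚ zero = 1ℚ
t ^ℚ suc k = t * (t ^ℚ k)

Σ₁ : ℕ → (ℕ → ℚ) → ℚ
Σ₁ zero    f = 0ℚ
Σ₁ (suc k) f = Σ₁ k f + f (suc k)

fac3≢0 : ∀ a b c → NonZero ((a !) ℕ.* (b !) ℕ.* (c !))
fac3≢0 a b c =
  m*n≢0 ((a !) ℕ.* (b !)) (c !) {{m*n≢0 (a !) (b !) {{a !≢0}} {{b !≢0}}}} {{c !≢0}}

-- the coefficient (n-i-1)! / ((d-i)! (n-d-i)! (i-1)!)
-- (truncated subtraction is harmless: only 1 ≤ i ≤ min(d, n-d) is used)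
coeff : ℕ → ℕ → ℕ → ℚ
coeff n d i =
  ((+ ((n ∸ i ∸ 1) !)) / ((d ∸ i) ! ℕ.* (n ∸ d ∸ i) ! ℕ.* (i ∸ 1) !))
    {{fac3≢0 (d ∸ i) (n ∸ d ∸ i) (i ∸ 1)}}

g : ℕ → ℕ → ℚ → ℚ
g n d t = Σ₁ (d ⊓ (n ∸ d)) (λ i → coeff n d i * (t ^ℚ i))

f : ℕ → ℚ → ℚ
f n t = g n (n ℕ./ 2) t

-- total division on ℚ (p/0 := 0); only used where the divisor is positive
_÷₀_ : ℚ → ℚ → ℚ
p ÷₀ q with q ≟ 0ℚ
... | yes _  = 0ℚ
... | no q≢0 = (p ÷ q) {{≢-nonZero q≢0}}

r : ℕ → ℚ
r m = f (2 ℕ.* m) 1ℚ ÷₀ f (suc (2 ℕ.* m)) 1ℚ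

-- At t = 1 the coefficient of t^i in g_{n,d} is the trinomial coefficient
-- ((d-i) + (n-d-i) + (i-1))! / ((d-i)! (n-d-i)! (i-1)!), so f_{2n+2}(1) and
-- f_{2n+3}(1) are the antidiagonal sums A n = Σ_{x+z=n} trinomial x x z and
-- B n = Σ_{x+z=n} trinomial x (1+x) z.  Pascal's rule for trinomial
-- coefficients yields A (n+1) = A n + 2 B n and
-- (n+2) B (n+1) = (2n+3) A n + (5n+7) B n.  With m = n+1 and r = A/B the claim
-- reads m A² + 2m AB < (m+1) B².  It holds at m = 3 (A = 13, B = 25), and the
-- recurrences carry it from m to m+1, because (m+1)² times the new gap
-- (m+2) B′² − (m+1) A′² − 2(m+1) A′B′ equals a positive multiple of the old gap
-- plus a polynomial in A, B with nonnegative coefficients.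

module Submission where

open import Defs
open import Relation.Binary.PropositionalEquality

module Trinomial where
  open import Data.Nat
  open import Data.Nat.Properties
  open import Data.Nat.Tactic.RingSolver using (solve-∀)
  open import Algebra.Properties.CommutativeSemigroup *-commutativeSemigroup using (x∙yz≈y∙xz)
  open ≡-Reasoning

  trinomial : ℕ → ℕ → ℕ → ℕ
  trinomial zero    zero    zero    = 1
  trinomial (suc x) zero    zero    = trinomial x 0 0
  trinomial zero    (suc y) zero    = trinomial 0 y 0
  trinomial zero    zero    (suc z) = trinomial 0 0 z
  trinomial (suc x) (suc y) zero    = trinomial x (suc y) 0 + trinomial (suc x) y 0
  trinomial (suc x) zero    (suc z) = trinomial x 0 (suc z) + trinomial (suc x) 0 z
  trinomial zero    (suc y) (suc z) = trinomial 0 y (suc z) + trinomial 0 (suc y) z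
  trinomial (suc x) (suc y) (suc z) =
    trinomial x (suc y) (suc z) + trinomial (suc x) y (suc z) + trinomial (suc x) (suc y) z

  factorials : ℕ → ℕ → ℕ → ℕ
  factorials x y z = x ! * y ! * z !

  factorials-cancelʳ : ∀ t u x y z → t * factorials x y z ≡ u * factorials x y z → t ≡ u
  factorials-cancelʳ t u x y z = *-cancelʳ-≡ t u (factorials x y z) {{fac3≢0 x y z}}

  factorials-sucˣ : ∀ x y z → factorials (suc x) y z ≡ suc x * factorials x y z
  factorials-sucˣ x y z = rearrange (suc x) (x !) (y !) (z !)
    where rearrange : ∀ k a b c → k * a * b * c ≡ k * (a * b * c)
          rearrange = solve-∀

  factorials-sucʸ : ∀ x y z → factorials x (suc y) z ≡ suc y * factorials x y z
  factorials-sucʸ x y z = rearrange (suc y) (x !) (y !) (z !)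
    where rearrange : ∀ k a b c → a * (k * b) * c ≡ k * (a * b * c)
          rearrange = solve-∀

  factorials-sucᶻ : ∀ x y z → factorials x y (suc z) ≡ suc z * factorials x y z
  factorials-sucᶻ x y z = rearrange (suc z) (x !) (y !) (z !)
    where rearrange : ∀ k a b c → a * b * (k * c) ≡ k * (a * b * c)
          rearrange = solve-∀

  rescale : ∀ t F k G → t * F ≡ G → t * (k * F) ≡ k * G
  rescale t F k G tF≡G = trans (x∙yz≈y∙xz t k F) (cong (k *_) tF≡G)

  trinomial-*-factorials : ∀ x y z → trinomial x y z * factorials x y z ≡ (x + y + z) !

  pascal-termˣ : ∀ x y z s → x + y + z ≡ s → trinomial x y z * factorials (suc x) y z ≡ suc x * s !
  pascal-termˣ x y z _ refl = trans (cong (trinomial x y z *_) (factorials-sucˣ x y z))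
    (rescale (trinomial x y z) (factorials x y z) (suc x) _ (trinomial-*-factorials x y z))

  pascal-termʸ : ∀ x y z s → x + y + z ≡ s → trinomial x y z * factorials x (suc y) z ≡ suc y * s !
  pascal-termʸ x y z _ refl = trans (cong (trinomial x y z *_) (factorials-sucʸ x y z))
    (rescale (trinomial x y z) (factorials x y z) (suc y) _ (trinomial-*-factorials x y z))

  pascal-termᶻ : ∀ x y z s → x + y + z ≡ s → trinomial x y z * factorials x y (suc z) ≡ suc z * s !
  pascal-termᶻ x y z _ refl = trans (cong (trinomial x y z *_) (factorials-sucᶻ x y z))
    (rescale (trinomial x y z) (factorials x y z) (suc z) _ (trinomial-*-factorials x y z))

  trinomial-*-factorials zero    zero    zero    = refl
  trinomial-*-factorials (suc x) zero    zero    =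
    trans (pascal-termˣ x 0 0 _ refl)
          (cong (λ w → suc w * (x + 0 + 0) !) (sym (trans (+-identityʳ (x + 0)) (+-identityʳ x))))
  trinomial-*-factorials zero    (suc y) zero    =
    trans (pascal-termʸ 0 y 0 _ refl) (cong (λ w → suc w * (y + 0) !) (sym (+-identityʳ y)))
  trinomial-*-factorials zero    zero    (suc z) = pascal-termᶻ 0 0 z _ refl
  trinomial-*-factorials (suc x) (suc y) zero    = begin
    (trinomial x (suc y) 0 + trinomial (suc x) y 0) * F
      ≡⟨ *-distribʳ-+ F (trinomial x (suc y) 0) (trinomial (suc x) y 0) ⟩
    trinomial x (suc y) 0 * F + trinomial (suc x) y 0 * F
      ≡⟨ cong₂ _+_ (pascal-termˣ x (suc y) 0 s refl) (pascal-termʸ (suc x) y 0 s (cong (_+ 0) (sym (+-suc x y)))) ⟩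
    suc x * s ! + suc y * s !
      ≡⟨ *-distribʳ-+ (s !) (suc x) (suc y) ⟨
    (suc x + suc y) * s !
      ≡⟨ cong (λ w → suc w * s !) (sym (+-identityʳ (x + suc y))) ⟩
    suc s * s ! ∎
    where F = factorials (suc x) (suc y) 0
          s = x + suc y + 0
  trinomial-*-factorials (suc x) zero    (suc z) = begin
    (trinomial x 0 (suc z) + trinomial (suc x) 0 z) * F
      ≡⟨ *-distribʳ-+ F (trinomial x 0 (suc z)) (trinomial (suc x) 0 z) ⟩
    trinomial x 0 (suc z) * F + trinomial (suc x) 0 z * F
      ≡⟨ cong₂ _+_ (pascal-termˣ x 0 (suc z) s refl) (pascal-termᶻ (suc x) 0 z s (sym (+-suc (x + 0) z))) ⟩
    suc x * s ! + suc z * s !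
      ≡⟨ *-distribʳ-+ (s !) (suc x) (suc z) ⟨
    (suc x + suc z) * s !
      ≡⟨ cong (λ w → suc (w + suc z) * s !) (sym (+-identityʳ x)) ⟩
    suc s * s ! ∎
    where F = factorials (suc x) 0 (suc z)
          s = x + 0 + suc z
  trinomial-*-factorials zero    (suc y) (suc z) = begin
    (trinomial 0 y (suc z) + trinomial 0 (suc y) z) * F
      ≡⟨ *-distribʳ-+ F (trinomial 0 y (suc z)) (trinomial 0 (suc y) z) ⟩
    trinomial 0 y (suc z) * F + trinomial 0 (suc y) z * F
      ≡⟨ cong₂ _+_ (pascal-termʸ 0 y (suc z) s refl) (pascal-termᶻ 0 (suc y) z s (sym (+-suc y z))) ⟩
    suc y * s ! + suc z * s !
      ≡⟨ *-distribʳ-+ (s !) (suc y) (suc z) ⟨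
    suc s * s ! ∎
    where F = factorials 0 (suc y) (suc z)
          s = y + suc z
  trinomial-*-factorials (suc x) (suc y) (suc z) = begin
    (t₁ + t₂ + t₃) * F
      ≡⟨ distribʳ₃ t₁ t₂ t₃ F ⟩
    t₁ * F + t₂ * F + t₃ * F
      ≡⟨ cong₂ _+_ (cong₂ _+_ (pascal-termˣ x (suc y) (suc z) s refl)
                              (pascal-termʸ (suc x) y (suc z) s (cong (_+ suc z) (sym (+-suc x y)))))
                   (pascal-termᶻ (suc x) (suc y) z s (sym (+-suc (x + suc y) z))) ⟩
    suc x * s ! + suc y * s ! + suc z * s !
      ≡⟨ distribʳ₃ (suc x) (suc y) (suc z) (s !) ⟨
    suc s * s ! ∎
    where t₁ = trinomial x (suc y) (suc z)
          t₂ = trinomial (suc x) y (suc z)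
          t₃ = trinomial (suc x) (suc y) z
          F = factorials (suc x) (suc y) (suc z)
          s = x + suc y + suc z
          distribʳ₃ : ∀ a b c d → (a + b + c) * d ≡ a * d + b * d + c * d
          distribʳ₃ = solve-∀

  trinomial-comm : ∀ x y z → trinomial x y z ≡ trinomial y x z
  trinomial-comm x y z = factorials-cancelʳ _ _ x y z (begin
    trinomial x y z * factorials x y z ≡⟨ trinomial-*-factorials x y z ⟩
    (x + y + z) !                      ≡⟨ cong (λ w → (w + z) !) (+-comm x y) ⟩
    (y + x + z) !                      ≡⟨ trinomial-*-factorials y x z ⟨
    trinomial y x z * factorials y x z ≡⟨ cong (λ w → trinomial y x z * (w * z !)) (*-comm (y !) (x !)) ⟩
    trinomial y x z * factorials x y z ∎)

  trinomial-0-0 : ∀ z → trinomial 0 0 z ≡ 1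
  trinomial-0-0 zero    = refl
  trinomial-0-0 (suc z) = trinomial-0-0 z

  trinomial-0-1 : ∀ z → trinomial 0 1 z ≡ suc z
  trinomial-0-1 zero    = refl
  trinomial-0-1 (suc z) = cong₂ _+_ (trinomial-0-0 z) (trinomial-0-1 z)

  trinomial-absorption : ∀ x z →
    trinomial (suc x) (2 + x) z + (suc x + z) * trinomial x (2 + x) z
      ≡ (2 + x + z) * trinomial (suc x) (suc x) z
  trinomial-absorption x z = factorials-cancelʳ _ _ (suc x) (2 + x) z (begin
    (t₁ + (suc x + z) * t₂) * F
      ≡⟨ distrib t₁ (suc x + z) t₂ F ⟩
    t₁ * F + (suc x + z) * (t₂ * F)
      ≡⟨ cong₂ (λ u v → u + (suc x + z) * v) (trinomial-*-factorials (suc x) (2 + x) z)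
                                             (pascal-termˣ x (2 + x) z s refl) ⟩
    suc s * s ! + (suc x + z) * (suc x * s !)
      ≡⟨ collect x z (s !) ⟩
    (2 + x + z) * ((2 + x) * s !)
      ≡⟨ cong ((2 + x + z) *_) (pascal-termʸ (suc x) (suc x) z s (cong (_+ z) (sym (+-suc x (suc x))))) ⟨
    (2 + x + z) * (t₃ * F)
      ≡⟨ *-assoc (2 + x + z) t₃ F ⟨
    (2 + x + z) * t₃ * F ∎)
    where t₁ = trinomial (suc x) (2 + x) z
          t₂ = trinomial x (2 + x) z
          t₃ = trinomial (suc x) (suc x) z
          F = factorials (suc x) (2 + x) z
          s = x + (2 + x) + z
          distrib : ∀ a c b d → (a + c * b) * d ≡ a * d + c * (b * d)
          distrib = solve-∀
          collect : ∀ x z G →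
            suc (x + (2 + x) + z) * G + (suc x + z) * (suc x * G) ≡ (2 + x + z) * ((2 + x) * G)
          collect = solve-∀

  degree-split : ∀ n d j → j < d → j < n ∸ d → n ∸ suc j ∸ 1 ≡ (d ∸ suc j) + (n ∸ d ∸ suc j) + j
  degree-split n d j j<d j<e = begin
    n ∸ suc j ∸ 1                   ≡⟨ cong (λ k → k ∸ suc j ∸ 1) (m+[n∸m]≡n d≤n) ⟨
    d + e ∸ suc j ∸ 1               ≡⟨ cong (_∸ 1) (+-∸-comm e j<d) ⟩
    (d ∸ suc j) + e ∸ 1             ≡⟨ +-∸-assoc (d ∸ suc j) (m<n⇒0<n j<e) ⟩
    (d ∸ suc j) + (e ∸ 1)           ≡⟨ cong ((d ∸ suc j) +_) (pred-split j<e) ⟩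
    (d ∸ suc j) + ((e ∸ suc j) + j) ≡⟨ +-assoc (d ∸ suc j) (e ∸ suc j) j ⟨
    (d ∸ suc j) + (e ∸ suc j) + j   ∎
    where e = n ∸ d
          d≤n : d ≤ n
          d≤n = <⇒≤ (m∸n≢0⇒n<m (m<n⇒n≢0 j<e))
          pred-split : ∀ {e} → j < e → e ∸ 1 ≡ (e ∸ suc j) + j
          pred-split {suc e} (s≤s j≤e) = sym (m∸n+n≡m j≤e)

open Trinomial

module Antidiagonal where
  open import Data.Nat
  open import Data.Nat.Properties
  open import Algebra.Properties.CommutativeSemigroup +-commutativeSemigroup using (interchange)

  antidiagonalSum : (ℕ → ℕ → ℕ) → ℕ → ℕ
  antidiagonalSum h zero    = h 0 0
  antidiagonalSum h (suc n) = h 0 (suc n) + antidiagonalSum (λ x z → h (suc x) z) n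

  antidiagonalSum-cong : ∀ n {h k : ℕ → ℕ → ℕ} → (∀ x z → x + z ≡ n → h x z ≡ k x z) →
                         antidiagonalSum h n ≡ antidiagonalSum k n
  antidiagonalSum-cong zero    h≗k = h≗k 0 0 refl
  antidiagonalSum-cong (suc n) h≗k =
    cong₂ _+_ (h≗k 0 (suc n) refl) (antidiagonalSum-cong n (λ x z e → h≗k (suc x) z (cong suc e)))

  antidiagonalSum-+ : ∀ n (h k : ℕ → ℕ → ℕ) →
                      antidiagonalSum (λ x z → h x z + k x z) n ≡ antidiagonalSum h n + antidiagonalSum k n
  antidiagonalSum-+ zero    h k = refl
  antidiagonalSum-+ (suc n) h k =
    trans (cong (h 0 (suc n) + k 0 (suc n) +_)
                (antidiagonalSum-+ n (λ x z → h (suc x) z) (λ x z → k (suc x) z)))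
          (interchange (h 0 (suc n)) (k 0 (suc n)) _ _)

  antidiagonalSum-* : ∀ n c (h : ℕ → ℕ → ℕ) →
                      antidiagonalSum (λ x z → c * h x z) n ≡ c * antidiagonalSum h n
  antidiagonalSum-* zero    c h = refl
  antidiagonalSum-* (suc n) c h =
    trans (cong (c * h 0 (suc n) +_) (antidiagonalSum-* n c (λ x z → h (suc x) z)))
          (sym (*-distribˡ-+ c (h 0 (suc n)) _))

  shiftˣ shiftᶻ : (ℕ → ℕ → ℕ) → ℕ → ℕ → ℕ
  shiftˣ h zero    z = 0
  shiftˣ h (suc x) z = h x z
  shiftᶻ h x zero    = 0
  shiftᶻ h x (suc z) = h x z

  antidiagonalSum-shiftˣ : ∀ n h → antidiagonalSum (shiftˣ h) (suc n) ≡ antidiagonalSum h n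
  antidiagonalSum-shiftˣ n h = refl

  antidiagonalSum-shiftᶻ : ∀ n h → antidiagonalSum (shiftᶻ h) (suc n) ≡ antidiagonalSum h n
  antidiagonalSum-shiftᶻ zero    h = +-identityʳ (h 0 0)
  antidiagonalSum-shiftᶻ (suc n) h = cong (h 0 (suc n) +_) (trans
    (antidiagonalSum-cong (suc n) (λ x z _ → shiftᶻ-suc x z))
    (antidiagonalSum-shiftᶻ n (λ x z → h (suc x) z)))
    where shiftᶻ-suc : ∀ x z → shiftᶻ h (suc x) z ≡ shiftᶻ (λ x z → h (suc x) z) x z
          shiftᶻ-suc x zero    = refl
          shiftᶻ-suc x (suc z) = refl

open Antidiagonal

module Recurrences where
  open import Data.Nat
  open import Data.Nat.Properties
  open import Data.Nat.Tactic.RingSolver using (solve-∀)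
  open ≡-Reasoning

  T : ℕ → ℕ → ℕ → ℕ
  T k x z = trinomial x (k + x) z

  A B C : ℕ → ℕ
  A = antidiagonalSum (T 0)
  B = antidiagonalSum (T 1)
  C = antidiagonalSum (T 2)

  A-suc : ∀ n → A (suc n) ≡ B n + B n + A n
  A-suc n = begin
    antidiagonalSum (T 0) (suc n)
      ≡⟨ antidiagonalSum-cong (suc n) pascal ⟩
    antidiagonalSum (λ x z → shiftˣ (T 1) x z + shiftˣ (T 1) x z + shiftᶻ (T 0) x z) (suc n)
      ≡⟨ antidiagonalSum-+ (suc n) (λ x z → shiftˣ (T 1) x z + shiftˣ (T 1) x z) (shiftᶻ (T 0)) ⟩
    antidiagonalSum (λ x z → shiftˣ (T 1) x z + shiftˣ (T 1) x z) (suc n) + antidiagonalSum (shiftᶻ (T 0)) (suc n)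
      ≡⟨ cong₂ _+_ (antidiagonalSum-+ (suc n) (shiftˣ (T 1)) (shiftˣ (T 1))) (antidiagonalSum-shiftᶻ n (T 0)) ⟩
    antidiagonalSum (shiftˣ (T 1)) (suc n) + antidiagonalSum (shiftˣ (T 1)) (suc n) + A n
      ≡⟨ cong (λ b → b + b + A n) (antidiagonalSum-shiftˣ n (T 1)) ⟩
    B n + B n + A n ∎
    where
      pascal : ∀ x z → x + z ≡ suc n → T 0 x z ≡ shiftˣ (T 1) x z + shiftˣ (T 1) x z + shiftᶻ (T 0) x z
      pascal zero    (suc z) _ = refl
      pascal (suc x) zero    _ =
        trans (cong (T 1 x 0 +_) (trinomial-comm (suc x) x 0)) (sym (+-identityʳ _))
      pascal (suc x) (suc z) _ =
        cong (λ t → T 1 x (suc z) + t + T 0 (suc x) z) (trinomial-comm (suc x) x (suc z))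

  B-suc : ∀ n → B (suc n) ≡ C n + A (suc n) + B n
  B-suc n = begin
    antidiagonalSum (T 1) (suc n)
      ≡⟨ antidiagonalSum-cong (suc n) pascal ⟩
    antidiagonalSum (λ x z → shiftˣ (T 2) x z + T 0 x z + shiftᶻ (T 1) x z) (suc n)
      ≡⟨ antidiagonalSum-+ (suc n) (λ x z → shiftˣ (T 2) x z + T 0 x z) (shiftᶻ (T 1)) ⟩
    antidiagonalSum (λ x z → shiftˣ (T 2) x z + T 0 x z) (suc n) + antidiagonalSum (shiftᶻ (T 1)) (suc n)
      ≡⟨ cong₂ _+_ (antidiagonalSum-+ (suc n) (shiftˣ (T 2)) (T 0)) (antidiagonalSum-shiftᶻ n (T 1)) ⟩
    antidiagonalSum (shiftˣ (T 2)) (suc n) + A (suc n) + B n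
      ≡⟨ cong (λ c → c + A (suc n) + B n) (antidiagonalSum-shiftˣ n (T 2)) ⟩
    C n + A (suc n) + B n ∎
    where
      pascal : ∀ x z → x + z ≡ suc n → T 1 x z ≡ shiftˣ (T 2) x z + T 0 x z + shiftᶻ (T 1) x z
      pascal zero    (suc z) _ = refl
      pascal (suc x) zero    _ = sym (+-identityʳ _)
      pascal (suc x) (suc z) _ = refl

  B-suc+C : ∀ n → B (suc n) + suc n * C n ≡ suc (suc n) * A (suc n)
  B-suc+C n = begin
    B (suc n) + suc n * antidiagonalSum (shiftˣ (T 2)) (suc n)
      ≡⟨ cong (B (suc n) +_) (antidiagonalSum-* (suc n) (suc n) (shiftˣ (T 2))) ⟨
    B (suc n) + antidiagonalSum (λ x z → suc n * shiftˣ (T 2) x z) (suc n)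
      ≡⟨ antidiagonalSum-+ (suc n) (T 1) (λ x z → suc n * shiftˣ (T 2) x z) ⟨
    antidiagonalSum (λ x z → T 1 x z + suc n * shiftˣ (T 2) x z) (suc n)
      ≡⟨ antidiagonalSum-cong (suc n) absorption ⟩
    antidiagonalSum (λ x z → suc (suc n) * T 0 x z) (suc n)
      ≡⟨ antidiagonalSum-* (suc n) (suc (suc n)) (T 0) ⟩
    suc (suc n) * A (suc n) ∎
    where
      absorption : ∀ x z → x + z ≡ suc n → T 1 x z + suc n * shiftˣ (T 2) x z ≡ suc (suc n) * T 0 x z
      absorption zero    _ refl = begin
        trinomial 0 1 (suc n) + suc n * 0 ≡⟨ cong₂ _+_ (trinomial-0-1 (suc n)) (*-zeroʳ (suc n)) ⟩
        suc (suc n) + 0                    ≡⟨ +-identityʳ _ ⟩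
        suc (suc n)                        ≡⟨ *-identityʳ _ ⟨
        suc (suc n) * 1                    ≡⟨ cong (suc (suc n) *_) (trinomial-0-0 (suc n)) ⟨
        suc (suc n) * trinomial 0 0 (suc n) ∎
      absorption (suc x) z refl = trinomial-absorption x z

  B-recurrence : ∀ n → suc (suc n) * B (suc n) ≡ (3 + 2 * n) * A n + (7 + 5 * n) * B n
  B-recurrence n = begin
    suc (suc n) * B (suc n)
      ≡⟨ cong (λ b′ → B (suc n) + suc n * b′) (B-suc n) ⟩
    B (suc n) + suc n * (C n + A (suc n) + B n)
      ≡⟨ regroup n (B (suc n)) (C n) (A (suc n)) (B n) ⟩
    (B (suc n) + suc n * C n) + suc n * (A (suc n) + B n)
      ≡⟨ cong (_+ suc n * (A (suc n) + B n)) (B-suc+C n) ⟩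
    suc (suc n) * A (suc n) + suc n * (A (suc n) + B n)
      ≡⟨ cong (λ a′ → suc (suc n) * a′ + suc n * (a′ + B n)) (A-suc n) ⟩
    suc (suc n) * (B n + B n + A n) + suc n * (B n + B n + A n + B n)
      ≡⟨ collect n (A n) (B n) ⟩
    (3 + 2 * n) * A n + (7 + 5 * n) * B n ∎
    where
      regroup : ∀ n b′ c a′ b → b′ + suc n * (c + a′ + b) ≡ (b′ + suc n * c) + suc n * (a′ + b)
      regroup = solve-∀
      collect : ∀ n a b →
        suc (suc n) * (b + b + a) + suc n * (b + b + a + b) ≡ (3 + 2 * n) * a + (7 + 5 * n) * b
      collect = solve-∀

open Recurrences

module Bound where
  open import Data.Nat
  open import Data.Nat.Properties
  open import Data.Nat.Tactic.RingSolver using (solve-∀)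
  open import Relation.Nullary using (contradiction)
  open import Relation.Nullary.Decidable using (toWitness)
  open ≤-Reasoning

  -- For ρ = a / b this is  m + 1 - 2 m ρ - m ρ² > 0  with the denominator b² cleared.
  RatioBound : ℕ → ℕ → ℕ → Set
  RatioBound m a b = m * (a * a) + 2 * m * (a * b) < suc m * (b * b)

  ratioBound⇒0<b : ∀ m a b → RatioBound m a b → 0 < b
  ratioBound⇒0<b m a zero    bound =
    contradiction (subst (m * (a * a) + 2 * m * (a * 0) <_) (*-zeroʳ (suc m)) bound) n≮0
  ratioBound⇒0<b m a (suc b) _     = z<s

  -- With n = 1 + j, a′ = 2b + a and (n + 2) b′ = w: the gap of RatioBound (2 + n) a′ b′,
  -- scaled by (n + 2)², is (n² + 5n + 5) times the gap of RatioBound (1 + n) a b plus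
  -- a polynomial with nonnegative coefficients (this is where n ≥ 1 is needed).
  certificate : ∀ j a b →
    let n = suc j
        p = 2 + n
        a′ = b + b + a
        w = (3 + 2 * n) * a + (7 + 5 * n) * b
        c = 5 + 5 * n + n * n
    in p * p * p * (a′ * a′) + 2 * p * p * (a′ * w)
         + (n * (2 * n + 3) * (a * a) + 4 * n * (2 * n + 3) * (a * b) + (6 * (j * j) + 16 * j + 3) * (b * b))
         + c * (suc (suc n) * (b * b))
       ≡ suc p * (w * w) + c * (suc n * (a * a) + 2 * suc n * (a * b))
  certificate = solve-∀

  ratioBound-step : ∀ n a b a′ b′ → 1 ≤ n → RatioBound (suc n) a b → a′ ≡ b + b + a →
                    suc (suc n) * b′ ≡ (3 + 2 * n) * a + (7 + 5 * n) * b → RatioBound (suc (suc n)) a′ b′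
  ratioBound-step (suc j) a b _ b′ _ bound refl recurrence =
    *-cancelˡ-< (p * p) _ _ (begin-strict
      p * p * (p * (a′ * a′) + 2 * p * (a′ * b′)) ≡⟨ scaleˡ p a′ b′ ⟩
      P (p * b′)                                  ≡⟨ cong P recurrence ⟩
      P w                                         <⟨ P<Q ⟩
      Q w                                         ≡⟨ cong Q recurrence ⟨
      Q (p * b′)                                  ≡⟨ scaleʳ p b′ ⟨
      p * p * (suc p * (b′ * b′))                 ∎)
    where
      n = suc j
      p = 2 + n
      a′ = b + b + a
      w = (3 + 2 * n) * a + (7 + 5 * n) * b
      c = 5 + 5 * n + n * n
      P Q : ℕ → ℕ
      P v = p * p * p * (a′ * a′) + 2 * p * p * (a′ * v)
      Q v = suc p * (v * v)
      S = n * (2 * n + 3) * (a * a) + 4 * n * (2 * n + 3) * (a * b) + (6 * (j * j) + 16 * j + 3) * (b * b)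
      L = suc n * (a * a) + 2 * suc n * (a * b)
      R = suc (suc n) * (b * b)
      P<Q : P w < Q w
      P<Q = +-cancelʳ-< (c * R) (P w) (Q w) (begin-strict
        P w + c * R     ≤⟨ +-monoˡ-≤ (c * R) (m≤m+n (P w) S) ⟩
        P w + S + c * R ≡⟨ certificate j a b ⟩
        Q w + c * L     <⟨ +-monoʳ-< (Q w) (*-monoʳ-< c bound) ⟩
        Q w + c * R     ∎)
      scaleˡ : ∀ p x y →
        p * p * (p * (x * x) + 2 * p * (x * y)) ≡ p * p * p * (x * x) + 2 * p * p * (x * (p * y))
      scaleˡ = solve-∀
      scaleʳ : ∀ p y → p * p * (suc p * (y * y)) ≡ suc p * ((p * y) * (p * y))
      scaleʳ = solve-∀

  A-B-ratioBound : ∀ k → RatioBound (3 + k) (A (2 + k)) (B (2 + k))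
  A-B-ratioBound zero    = toWitness {a? = _ <? _} _
  A-B-ratioBound (suc k) = ratioBound-step (2 + k) (A (2 + k)) (B (2 + k)) (A (3 + k)) (B (3 + k))
                             (s≤s z≤n) (A-B-ratioBound k) (A-suc (2 + k)) (B-recurrence (2 + k))

open Bound

-- The ℕ development above sits in modules so that, from here on, the unqualified
-- arithmetic operators are those of ℚ, as in the statement.
open import Data.Nat using (ℕ; zero; suc; _∸_; _⊓_; z≤n; s≤s; _≥_)
import Data.Nat as ℕ
import Data.Nat.Properties as ℕ
open import Data.Integer as ℤ using (+_)
import Data.Integer.Properties as ℤ
open import Data.Rational
  using (ℚ; 0ℚ; 1ℚ; _<_; _+_; _-_; _*_; _/_; 1/_; fromℚᵘ; ≢-nonZero; NonNegative; nonNegative)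
import Data.Rational.Properties as ℚ
open import Data.Rational.Solver using (module +-*-Solver)
import Data.Rational.Unnormalised as ℚᵘ
import Data.Rational.Unnormalised.Properties as ℚᵘ
open import Relation.Nullary using (yes; no; contradiction)
open import Data.Product using (_,_)
open import Data.Nat.DivMod using (m*n/n≡m; +-distrib-/-∣ʳ)
open import Data.Nat.Divisibility using (m∣m*n)

fromℚᵘ-+ : ∀ p q → fromℚᵘ (p ℚᵘ.+ q) ≡ fromℚᵘ p + fromℚᵘ q
fromℚᵘ-+ p q = ℚ.toℚᵘ-injective (ℚᵘ.≃-trans (ℚ.toℚᵘ-fromℚᵘ (p ℚᵘ.+ q)) (ℚᵘ.≃-sym (ℚᵘ.≃-trans
  (ℚ.toℚᵘ-homo-+ (fromℚᵘ p) (fromℚᵘ q)) (ℚᵘ.+-cong (ℚ.toℚᵘ-fromℚᵘ p) (ℚ.toℚᵘ-fromℚᵘ q)))))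

fromℚᵘ-* : ∀ p q → fromℚᵘ (p ℚᵘ.* q) ≡ fromℚᵘ p * fromℚᵘ q
fromℚᵘ-* p q = ℚ.toℚᵘ-injective (ℚᵘ.≃-trans (ℚ.toℚᵘ-fromℚᵘ (p ℚᵘ.* q)) (ℚᵘ.≃-sym (ℚᵘ.≃-trans
  (ℚ.toℚᵘ-homo-* (fromℚᵘ p) (fromℚᵘ q)) (ℚᵘ.*-cong (ℚ.toℚᵘ-fromℚᵘ p) (ℚ.toℚᵘ-fromℚᵘ q)))))

ℕtoℚᵘ : ℕ → ℚᵘ.ℚᵘ
ℕtoℚᵘ k = ℚᵘ.mkℚᵘ (+ k) 0

ℕtoℚᵘ-+ : ∀ a b → ℕtoℚᵘ (a ℕ.+ b) ℚᵘ.≃ ℕtoℚᵘ a ℚᵘ.+ ℕtoℚᵘ b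
ℕtoℚᵘ-+ a b = ℚᵘ.*≡* (begin
  + (a ℕ.+ b) ℤ.* + 1                   ≡⟨ cong (ℤ._* + 1) (ℤ.pos-+ a b) ⟩
  (+ a ℤ.+ + b) ℤ.* + 1                 ≡⟨ cong₂ (λ u v → (u ℤ.+ v) ℤ.* + 1) (ℤ.*-identityʳ (+ a))
                                                                             (ℤ.*-identityʳ (+ b)) ⟨
  (+ a ℤ.* + 1 ℤ.+ + b ℤ.* + 1) ℤ.* + 1 ∎)
  where open ≡-Reasoning

ℕtoℚᵘ-* : ∀ a b → ℕtoℚᵘ (a ℕ.* b) ℚᵘ.≃ ℕtoℚᵘ a ℚᵘ.* ℕtoℚᵘ b
ℕtoℚᵘ-* a b = ℚᵘ.*≡* (cong (ℤ._* + 1) (ℤ.pos-* a b))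

-- ℕtoℚ k is definitionally fromℚᵘ (ℕtoℚᵘ k).
ℕtoℚ-+ : ∀ a b → ℕtoℚ (a ℕ.+ b) ≡ ℕtoℚ a + ℕtoℚ b
ℕtoℚ-+ a b = trans (ℚ.fromℚᵘ-cong (ℕtoℚᵘ-+ a b)) (fromℚᵘ-+ (ℕtoℚᵘ a) (ℕtoℚᵘ b))

ℕtoℚ-* : ∀ a b → ℕtoℚ (a ℕ.* b) ≡ ℕtoℚ a * ℕtoℚ b
ℕtoℚ-* a b = trans (ℚ.fromℚᵘ-cong (ℕtoℚᵘ-* a b)) (fromℚᵘ-* (ℕtoℚᵘ a) (ℕtoℚᵘ b))

ℕtoℚ-pos : ∀ {k} → 0 ℕ.< k → 0ℚ < ℕtoℚ k
ℕtoℚ-pos {suc k} _ = ℚ.positive⁻¹ (ℕtoℚ (suc k)) {{ℚ.normalize-pos (suc k) 1}}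

ℕtoℚ-m<n⇒0<n-m : ∀ {m n} → m ℕ.< n → 0ℚ < ℕtoℚ n - ℕtoℚ m
ℕtoℚ-m<n⇒0<n-m {m} m<n with ℕ.m≤n⇒∃[o]m+o≡n m<n
... | o , refl = subst (0ℚ <_) (sym (begin
    ℕtoℚ (suc m ℕ.+ o) - ℕtoℚ m   ≡⟨ cong (λ k → ℕtoℚ k - ℕtoℚ m) (sym (ℕ.+-suc m o)) ⟩
    ℕtoℚ (m ℕ.+ suc o) - ℕtoℚ m   ≡⟨ cong (_- ℕtoℚ m) (ℕtoℚ-+ m (suc o)) ⟩
    ℕtoℚ m + ℕtoℚ (suc o) - ℕtoℚ m ≡⟨ solve 2 (λ x y → x :+ y :- x := y) refl (ℕtoℚ m) (ℕtoℚ (suc o)) ⟩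
    ℕtoℚ (suc o)                   ∎))
  (ℕtoℚ-pos {suc o} ℕ.z<s)
  where open ≡-Reasoning
        open +-*-Solver

[m*n]/n≡m : ∀ m n .{{_ : ℕ.NonZero n}} → (+ (m ℕ.* n)) / n ≡ ℕtoℚ m
[m*n]/n≡m m (suc n) = ℚ.fromℚᵘ-cong {ℚᵘ.mkℚᵘ (+ (m ℕ.* suc n)) n} {ℕtoℚᵘ m}
  (ℚᵘ.*≡* (trans (ℤ.*-identityʳ _) (ℤ.pos-* m (suc n))))

÷₀-*-cancel : ∀ p q → q ≢ 0ℚ → (p ÷₀ q) * q ≡ p
÷₀-*-cancel p q q≢0 with q ℚ.≟ 0ℚ
... | yes q≡0 = contradiction q≡0 q≢0
... | no  q≢0 = begin
  p * 1/ q * q   ≡⟨ ℚ.*-assoc p (1/ q) q ⟩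
  p * (1/ q * q) ≡⟨ cong (p *_) (ℚ.*-inverseˡ q) ⟩
  p * 1ℚ         ≡⟨ ℚ.*-identityʳ p ⟩
  p              ∎
  where open ≡-Reasoning
        instance _ = ≢-nonZero q≢0

Σ₁-cong : ∀ k {u v : ℕ → ℚ} → (∀ i → 1 ℕ.≤ i → i ℕ.≤ k → u i ≡ v i) → Σ₁ k u ≡ Σ₁ k v
Σ₁-cong zero    u≗v = refl
Σ₁-cong (suc k) u≗v =
  cong₂ _+_ (Σ₁-cong k (λ i 1≤i i≤k → u≗v i 1≤i (ℕ.m≤n⇒m≤1+n i≤k))) (u≗v (suc k) (s≤s z≤n) ℕ.≤-refl)

Σ₁-antidiagonal : ∀ n h → Σ₁ (suc n) (λ i → ℕtoℚ (h (suc n ∸ i) (i ∸ 1))) ≡ ℕtoℚ (antidiagonalSum h n)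
Σ₁-antidiagonal zero    h = ℚ.+-identityˡ (ℕtoℚ (h 0 0))
Σ₁-antidiagonal (suc n) h = begin
  Σ₁ (suc n) (λ i → ℕtoℚ (h (2 ℕ.+ n ∸ i) (i ∸ 1))) + ℕtoℚ (h (n ∸ n) (suc n))
    ≡⟨ cong₂ _+_ (Σ₁-cong (suc n) shift) (cong (λ x → ℕtoℚ (h x (suc n))) (ℕ.n∸n≡0 n)) ⟩
  Σ₁ (suc n) (λ i → ℕtoℚ (h (suc (suc n ∸ i)) (i ∸ 1))) + ℕtoℚ (h 0 (suc n))
    ≡⟨ cong (_+ ℕtoℚ (h 0 (suc n))) (Σ₁-antidiagonal n (λ x z → h (suc x) z)) ⟩
  ℕtoℚ (antidiagonalSum (λ x z → h (suc x) z) n) + ℕtoℚ (h 0 (suc n))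
    ≡⟨ ℚ.+-comm (ℕtoℚ (antidiagonalSum (λ x z → h (suc x) z) n)) (ℕtoℚ (h 0 (suc n))) ⟩
  ℕtoℚ (h 0 (suc n)) + ℕtoℚ (antidiagonalSum (λ x z → h (suc x) z) n)
    ≡⟨ ℕtoℚ-+ (h 0 (suc n)) _ ⟨
  ℕtoℚ (antidiagonalSum h (suc n)) ∎
  where open ≡-Reasoning
        shift : ∀ i → 1 ℕ.≤ i → i ℕ.≤ suc n →
                ℕtoℚ (h (2 ℕ.+ n ∸ i) (i ∸ 1)) ≡ ℕtoℚ (h (suc (suc n ∸ i)) (i ∸ 1))
        shift i _ i≤1+n = cong (λ x → ℕtoℚ (h x (i ∸ 1))) (ℕ.+-∸-assoc 1 i≤1+n)

1^i≡1 : ∀ i → 1ℚ ^ℚ i ≡ 1ℚ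
1^i≡1 zero    = refl
1^i≡1 (suc i) = trans (ℚ.*-identityˡ (1ℚ ^ℚ i)) (1^i≡1 i)

coeff-trinomial : ∀ n d i → n ∸ i ∸ 1 ≡ (d ∸ i) ℕ.+ (n ∸ d ∸ i) ℕ.+ (i ∸ 1) →
                  coeff n d i ≡ ℕtoℚ (trinomial (d ∸ i) (n ∸ d ∸ i) (i ∸ 1))
coeff-trinomial n d i degrees =
  trans (cong (λ k → ((+ k) / factorials x y z) {{fac3≢0 x y z}})
              (trans (cong ℕ._! degrees) (sym (trinomial-*-factorials x y z))))
        ([m*n]/n≡m (trinomial x y z) (factorials x y z) {{fac3≢0 x y z}})
  where x = d ∸ i
        y = n ∸ d ∸ i
        z = i ∸ 1

g-at-one : ∀ n d → g n d 1ℚ ≡ Σ₁ (d ⊓ (n ∸ d)) (λ i → ℕtoℚ (trinomial (d ∸ i) (n ∸ d ∸ i) (i ∸ 1)))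
g-at-one n d = Σ₁-cong (d ⊓ (n ∸ d)) term
  where
    open ≡-Reasoning
    term : ∀ i → 1 ℕ.≤ i → i ℕ.≤ d ⊓ (n ∸ d) →
           coeff n d i * (1ℚ ^ℚ i) ≡ ℕtoℚ (trinomial (d ∸ i) (n ∸ d ∸ i) (i ∸ 1))
    term (suc j) _ i≤d⊓e = begin
      coeff n d (suc j) * (1ℚ ^ℚ suc j) ≡⟨ cong (coeff n d (suc j) *_) (1^i≡1 (suc j)) ⟩
      coeff n d (suc j) * 1ℚ            ≡⟨ ℚ.*-identityʳ _ ⟩
      coeff n d (suc j)                 ≡⟨ coeff-trinomial n d (suc j) (degree-split n d j
                                             (ℕ.m<n⊓o⇒m<n d (n ∸ d) i≤d⊓e) (ℕ.m<n⊓o⇒m<o d (n ∸ d) i≤d⊓e)) ⟩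
      ℕtoℚ (trinomial (d ∸ suc j) (n ∸ d ∸ suc j) j) ∎

g[d+e,d]-at-one : ∀ d e → g (d ℕ.+ e) d 1ℚ ≡ Σ₁ (d ⊓ e) (λ i → ℕtoℚ (trinomial (d ∸ i) (e ∸ i) (i ∸ 1)))
g[d+e,d]-at-one d e =
  subst (λ k → g (d ℕ.+ e) d 1ℚ ≡ Σ₁ (d ⊓ k) (λ i → ℕtoℚ (trinomial (d ∸ i) (k ∸ i) (i ∸ 1))))
        (ℕ.m+n∸m≡n d e) (g-at-one (d ℕ.+ e) d)

2*m≡m+m : ∀ m → 2 ℕ.* m ≡ m ℕ.+ m
2*m≡m+m m = cong (m ℕ.+_) (ℕ.+-identityʳ m)

[2*m]/2≡m : ∀ m → 2 ℕ.* m ℕ./ 2 ≡ m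
[2*m]/2≡m m = trans (cong (ℕ._/ 2) (ℕ.*-comm 2 m)) (m*n/n≡m m 2)

[1+2*m]/2≡m : ∀ m → suc (2 ℕ.* m) ℕ./ 2 ≡ m
[1+2*m]/2≡m m = trans (+-distrib-/-∣ʳ 1 {d = 2} (m∣m*n m)) ([2*m]/2≡m m)

f-even : ∀ n → f (2 ℕ.* suc n) 1ℚ ≡ ℕtoℚ (A n)
f-even n = begin
  g (2 ℕ.* m) (2 ℕ.* m ℕ./ 2) 1ℚ
    ≡⟨ cong₂ (λ N d → g N d 1ℚ) (2*m≡m+m m) ([2*m]/2≡m m) ⟩
  g (m ℕ.+ m) m 1ℚ
    ≡⟨ g[d+e,d]-at-one m m ⟩
  Σ₁ (m ⊓ m) (λ i → ℕtoℚ (trinomial (m ∸ i) (m ∸ i) (i ∸ 1)))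
    ≡⟨ cong (λ k → Σ₁ k (λ i → ℕtoℚ (trinomial (m ∸ i) (m ∸ i) (i ∸ 1)))) (ℕ.⊓-idem m) ⟩
  Σ₁ m (λ i → ℕtoℚ (trinomial (m ∸ i) (m ∸ i) (i ∸ 1)))
    ≡⟨ Σ₁-antidiagonal n (T 0) ⟩
  ℕtoℚ (A n) ∎
  where open ≡-Reasoning
        m = suc n

f-odd : ∀ n → f (suc (2 ℕ.* suc n)) 1ℚ ≡ ℕtoℚ (B n)
f-odd n = begin
  g (suc (2 ℕ.* m)) (suc (2 ℕ.* m) ℕ./ 2) 1ℚ
    ≡⟨ cong₂ (λ N d → g N d 1ℚ) (trans (cong suc (2*m≡m+m m)) (sym (ℕ.+-suc m m))) ([1+2*m]/2≡m m) ⟩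
  g (m ℕ.+ suc m) m 1ℚ
    ≡⟨ g[d+e,d]-at-one m (suc m) ⟩
  Σ₁ (m ⊓ suc m) (λ i → ℕtoℚ (trinomial (m ∸ i) (suc m ∸ i) (i ∸ 1)))
    ≡⟨ cong (λ k → Σ₁ k (λ i → ℕtoℚ (trinomial (m ∸ i) (suc m ∸ i) (i ∸ 1)))) (ℕ.m≤n⇒m⊓n≡m (ℕ.n≤1+n m)) ⟩
  Σ₁ m (λ i → ℕtoℚ (trinomial (m ∸ i) (suc m ∸ i) (i ∸ 1)))
    ≡⟨ Σ₁-cong m (λ i _ i≤m → cong (λ y → ℕtoℚ (trinomial (m ∸ i) y (i ∸ 1))) (ℕ.+-∸-assoc 1 i≤m)) ⟩
  Σ₁ m (λ i → ℕtoℚ (trinomial (m ∸ i) (suc (m ∸ i)) (i ∸ 1)))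
    ≡⟨ Σ₁-antidiagonal n (T 1) ⟩
  ℕtoℚ (B n) ∎
  where open ≡-Reasoning
        m = suc n

r≡A÷₀B : ∀ n → r (suc n) ≡ ℕtoℚ (A n) ÷₀ ℕtoℚ (B n)
r≡A÷₀B n = cong₂ _÷₀_ (f-even n) (f-odd n)

ratioBound⇒positive : ∀ m a b → RatioBound m a b →
  0ℚ < ℕtoℚ m + 1ℚ - ℕtoℚ (2 ℕ.* m) * (ℕtoℚ a ÷₀ ℕtoℚ b) - ℕtoℚ m * ((ℕtoℚ a ÷₀ ℕtoℚ b) * (ℕtoℚ a ÷₀ ℕtoℚ b))
ratioBound⇒positive m a b bound =
  ℚ.*-cancelʳ-<-nonNeg (β * β) (subst₂ _<_ (sym (ℚ.*-zeroˡ (β * β))) (sym cleared) (ℕtoℚ-m<n⇒0<n-m bound))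
  where
    α = ℕtoℚ a
    β = ℕtoℚ b
    μ = ℕtoℚ m
    τ = ℕtoℚ (2 ℕ.* m)
    ρ = α ÷₀ β
    β>0 : 0ℚ < β
    β>0 = ℕtoℚ-pos (ratioBound⇒0<b m a b bound)
    instance
      β≥0 : NonNegative β
      β≥0 = nonNegative (ℚ.<⇒≤ β>0)
      β*β≥0 : NonNegative (β * β)
      β*β≥0 = ℚ.nonNeg*nonNeg⇒nonNeg β β
    ℕtoℚ-R : ℕtoℚ (suc m ℕ.* (b ℕ.* b)) ≡ (1ℚ + μ) * (β * β)
    ℕtoℚ-R = trans (ℕtoℚ-* (suc m) (b ℕ.* b)) (cong₂ _*_ (ℕtoℚ-+ 1 m) (ℕtoℚ-* b b))
    ℕtoℚ-L : ℕtoℚ (m ℕ.* (a ℕ.* a) ℕ.+ 2 ℕ.* m ℕ.* (a ℕ.* b)) ≡ μ * (α * α) + τ * (α * β)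
    ℕtoℚ-L = trans (ℕtoℚ-+ (m ℕ.* (a ℕ.* a)) (2 ℕ.* m ℕ.* (a ℕ.* b)))
      (cong₂ _+_ (trans (ℕtoℚ-* m (a ℕ.* a)) (cong (μ *_) (ℕtoℚ-* a a)))
                 (trans (ℕtoℚ-* (2 ℕ.* m) (a ℕ.* b)) (cong (τ *_) (ℕtoℚ-* a b))))
    cleared : (μ + 1ℚ - τ * ρ - μ * (ρ * ρ)) * (β * β)
              ≡ ℕtoℚ (suc m ℕ.* (b ℕ.* b)) - ℕtoℚ (m ℕ.* (a ℕ.* a) ℕ.+ 2 ℕ.* m ℕ.* (a ℕ.* b))
    cleared = begin
      (μ + 1ℚ - τ * ρ - μ * (ρ * ρ)) * (β * β)
        ≡⟨ solve 4 (λ μ τ ρ β → (μ :+ con 1ℚ :- τ :* ρ :- μ :* (ρ :* ρ)) :* (β :* β)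
                              := (con 1ℚ :+ μ) :* (β :* β) :- (μ :* ((ρ :* β) :* (ρ :* β)) :+ τ :* ((ρ :* β) :* β)))
                 refl μ τ ρ β ⟩
      (1ℚ + μ) * (β * β) - (μ * ((ρ * β) * (ρ * β)) + τ * ((ρ * β) * β))
        ≡⟨ cong (λ x → (1ℚ + μ) * (β * β) - (μ * (x * x) + τ * (x * β))) (÷₀-*-cancel α β (≢-sym (ℚ.<⇒≢ β>0))) ⟩
      (1ℚ + μ) * (β * β) - (μ * (α * α) + τ * (α * β))
        ≡⟨ cong₂ _-_ (sym ℕtoℚ-R) (sym ℕtoℚ-L) ⟩
      ℕtoℚ (suc m ℕ.* (b ℕ.* b)) - ℕtoℚ (m ℕ.* (a ℕ.* a) ℕ.+ 2 ℕ.* m ℕ.* (a ℕ.* b)) ∎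
      where open ≡-Reasoning
            open +-*-Solver

lemma4p7 : (m : ℕ) → m ≥ 3 →
    0ℚ < ℕtoℚ m + 1ℚ - ℕtoℚ (2 Data.Nat.* m) * r m - ℕtoℚ m * (r m * r m)
lemma4p7 (suc (suc (suc k))) (s≤s (s≤s (s≤s z≤n))) =
  subst (λ ρ → 0ℚ < ℕtoℚ m + 1ℚ - ℕtoℚ (2 ℕ.* m) * ρ - ℕtoℚ m * (ρ * ρ))
        (sym (r≡A÷₀B n))
        (ratioBound⇒positive m (A n) (B n) (A-B-ratioBound k))
  where n = 2 ℕ.+ k
        m = suc n
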